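{- Let $n\ge 2r\ge 2$ and let $f$ be a bijection from the vertex set of $K(n,r)$ onto $[1,\binom{n}{r}]$. Let $F=[x,y]\subseteq[1,\binom{n}{r}]$ be an interval of integers with $x\le y$, and suppose $G$ is a right blocker of $F$ (with respect to $f$). Then $$\partial(F)\le \max\left\{\,y-1,\ \binom{n}{r}-(|G|+x)\right\}.$$
   Context: The Kneser graph $K(n,r)$ has as vertices the $r$-element subsets of $[n]=\{1,\dots,n\}$, two vertices adjacent iff the corresponding $r$-sets are disjoint. For integers $a\le b$, $[a,b]$ denotes the set of integers $z$ with $a\le z\le b$. Given the bijection $f$, a set of integers $A\subseteq[1,\binom{n}{r}]$ is identified with the set of vertices $f^{ -1}(A)$ (i.e. a family of $r$-subsets of $[n]$). For subsets $F,G\subseteq[1,\binom{n}{r}]$, $G$ is called a right blocker of $F$ if (a) $G=[u,\binom{n}{r}]$ for some integer $u$ with $\frac12\binom{n}{r}<u<\binom{n}{r}$, and (b) $f^{ -1}(F)$ and $f^{ -1}(G)$ are cross-intersecting, i.e. $v\cap w\neq\emptyset$ for every $v\in f^{ -1}(F)$ and $w\in f^{ -1}(G)$ (viewing vertices as $r$-sets). For $F\subseteq[1,\binom{n}{r}]$, $\partial(F)=\max\{|f(v)-f(w)| : vw \text{ is an edge of } K(n,r) \text{ and } f(v)\in F \text{ or } f(w)\in F\}$. -}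

module Defs where

open import Data.Nat using (ℕ; suc; _+_; _∸_; _≤_; _<_; _*_; ∣_-_∣; _⊔_)
open import Data.Nat.Combinatorics using (_C_)
open import Data.Fin using (Fin; toℕ)
open import Data.Fin.Subset using (Subset; _∈_; ∣_∣)
open import Data.Product using (Σ; _×_; proj₁)
open import Data.Sum using (_⊎_)
open import Data.Empty using (⊥)
open import Relation.Nullary using (¬_)
open import Relation.Binary.PropositionalEquality using (_≡_)
open import Function.Bundles using (_⤖_; Bijection)

KVertex : ℕ → ℕ → Set
KVertex n r = Σ (Subset n) (λ s → ∣ s ∣ ≡ r)

Disjoint : ∀ {n r} → KVertex n r → KVertex n r → Set
Disjoint {n} v w = (i : Fin n) → i ∈ proj₁ v → i ∈ proj₁ w → ⊥

Adjacent : ∀ {n r} → KVertex n r → KVertex n r → Set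
Adjacent v w = Disjoint v w

-- A labelling: a bijection f from V(K(n,r)) onto [1, C(n,r)],
-- represented as a bijection onto Fin (n C r) shifted by one.
Labelling : ℕ → ℕ → Set
Labelling n r = KVertex n r ⤖ Fin (n C r)

label : ∀ {n r} → Labelling n r → KVertex n r → ℕ
label f v = suc (toℕ (Bijection.to f v))

InInterval : ℕ → ℕ → ℕ → Set
InInterval a b z = a ≤ z × z ≤ b

CrossIntersectingIntervals : ∀ {n r} → Labelling n r → ℕ → ℕ → ℕ → ℕ → Set
CrossIntersectingIntervals {n} {r} f x y u w =
  (v v' : KVertex n r) → InInterval x y (label f v) → InInterval u w (label f v') →
  ¬ Disjoint v v'

-- G = [u, C(n,r)] is a right blocker of F = [x,y]:
--   C(n,r)/2 < u < C(n,r)  and f^{-1}(F), f^{-1}(G) cross-intersecting.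
RightBlocker : ∀ {n r} → Labelling n r → (x y u : ℕ) → Set
RightBlocker {n} {r} f x y u =
  (n C r < 2 * u) × (u < n C r) × CrossIntersectingIntervals f x y u (n C r)

-- ∂(F) ≤ M for F = [x,y]: every edge vw of K(n,r) with f(v) ∈ F or f(w) ∈ F
-- satisfies |f(v) - f(w)| ≤ M  (unfolding of "max{...} ≤ M").
BoundaryAtMost : ∀ {n r} → Labelling n r → (x y M : ℕ) → Set
BoundaryAtMost {n} {r} f x y M =
  (v w : KVertex n r) → Adjacent v w →
  (InInterval x y (label f v) ⊎ InInterval x y (label f w)) →
  ∣ label f v - label f w ∣ ≤ M

-- A neighbour w of a vertex v labelled in F = [x, y] cannot be labelled in the right
-- blocker G = [u, N], so 1 ≤ f(w) < u.  If f(w) ≤ f(v) the gap is at most y − 1; otherwise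
-- it is at most (u − 1) − x = N − (|G| + x).
module Submission where

open import Defs
open import Data.Nat using (ℕ; suc; pred; _+_; _∸_; _≤_; _<_; _*_; _⊔_; ∣_-_∣; s≤s; z≤n)
open import Data.Nat.Combinatorics using (_C_)
open import Data.Nat.Properties
open import Data.Fin.Properties using (toℕ<n)
open import Data.Product using (_,_)
open import Data.Sum using (inj₁; inj₂)
open import Relation.Nullary using (yes; no; contradiction)
open import Relation.Binary.PropositionalEquality using (_≡_; sym; cong; subst; module ≡-Reasoning)
open import Function.Bundles using (Bijection)

Disjoint-sym : ∀ {n r} {v w : KVertex n r} → Disjoint v w → Disjoint w v
Disjoint-sym v∩w=∅ i i∈w i∈v = v∩w=∅ i i∈v i∈w

module _ {n r : ℕ} (f : Labelling n r) where

  1≤label : ∀ v → 1 ≤ label f v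
  1≤label v = s≤s z≤n

  label≤N : ∀ v → label f v ≤ n C r
  label≤N v = toℕ<n (Bijection.to f v)

  neighbour-label<blocker : ∀ {x y u} → RightBlocker f x y u → ∀ {v w} →
                            InInterval x y (label f v) → Adjacent v w → label f w < u
  neighbour-label<blocker {u = u} (_ , _ , crossIntersecting) {v} {w} v∈F v∩w=∅ with u ≤? label f w
  ... | yes w∈G = contradiction v∩w=∅ (crossIntersecting v w v∈F (w∈G , label≤N w))
  ... | no  w∉G = ≰⇒> w∉G

N∸[1+N∸u+x]≡pred[u]∸x : ∀ {N u} x → u ≤ N → N ∸ (suc (N ∸ u) + x) ≡ pred u ∸ x
N∸[1+N∸u+x]≡pred[u]∸x {N} {u} x u≤N = begin
  N ∸ (suc (N ∸ u) + x)    ≡⟨ sym (∸-+-assoc N (suc (N ∸ u)) x) ⟩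
  N ∸ suc (N ∸ u) ∸ x      ≡⟨ cong (_∸ x) (sym (pred[m∸n]≡m∸[1+n] N (N ∸ u))) ⟩
  pred (N ∸ (N ∸ u)) ∸ x   ≡⟨ cong (λ m → pred m ∸ x) (m∸[m∸n]≡n u≤N) ⟩
  pred u ∸ x               ∎
  where open ≡-Reasoning

∣a-b∣≤blockerBound : ∀ {N u x y a b} → u ≤ N → x ≤ a → a ≤ y → 1 ≤ b → b < u →
                     ∣ a - b ∣ ≤ (y ∸ 1) ⊔ (N ∸ (suc (N ∸ u) + x))
∣a-b∣≤blockerBound {N} {u} {x} {y} {a} {b} u≤N x≤a a≤y 1≤b b<u with ≤-total b a
... | inj₁ b≤a = begin
  ∣ a - b ∣                      ≡⟨ m≤n⇒∣n-m∣≡n∸m b≤a ⟩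
  a ∸ b                          ≤⟨ ∸-mono a≤y 1≤b ⟩
  y ∸ 1                          ≤⟨ m≤m⊔n _ _ ⟩
  (y ∸ 1) ⊔ (N ∸ (suc (N ∸ u) + x)) ∎
  where open ≤-Reasoning
... | inj₂ a≤b = begin
  ∣ a - b ∣                      ≡⟨ m≤n⇒∣m-n∣≡n∸m a≤b ⟩
  b ∸ a                          ≤⟨ ∸-mono (<⇒≤pred b<u) x≤a ⟩
  pred u ∸ x                     ≡⟨ sym (N∸[1+N∸u+x]≡pred[u]∸x x u≤N) ⟩
  N ∸ (suc (N ∸ u) + x)          ≤⟨ m≤n⊔m _ _ ⟩
  (y ∸ 1) ⊔ (N ∸ (suc (N ∸ u) + x)) ∎
  where open ≤-Reasoning

lemma3p1 : (n r : ℕ) → 1 ≤ r → 2 * r ≤ n → (f : Labelling n r) → (x y u : ℕ) → 1 ≤ x → x ≤ y → y ≤ n C r → RightBlocker f x y u → BoundaryAtMost f x y ((y ∸ 1) ⊔ (n C r ∸ (suc (n C r ∸ u) + x)))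
lemma3p1 n r _ _ f x y u _ _ _ blocker@(_ , u<N , _) = edgeBound
  where
  inF⇒bound : ∀ v w → Adjacent v w → InInterval x y (label f v) →
              ∣ label f v - label f w ∣ ≤ (y ∸ 1) ⊔ (n C r ∸ (suc (n C r ∸ u) + x))
  inF⇒bound v w adj v∈F@(x≤fv , fv≤y) =
    ∣a-b∣≤blockerBound (<⇒≤ u<N) x≤fv fv≤y (1≤label f w)
      (neighbour-label<blocker f blocker v∈F adj)

  edgeBound : BoundaryAtMost f x y ((y ∸ 1) ⊔ (n C r ∸ (suc (n C r ∸ u) + x)))
  edgeBound v w adj (inj₁ v∈F) = inF⇒bound v w adj v∈F
  edgeBound v w adj (inj₂ w∈F) =
    subst (_≤ _) (∣-∣-comm (label f w) (label f v)) (inF⇒bound w v (Disjoint-sym {v = v} {w} adj) w∈F)
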